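{- Assume every literal on the trail $\tau$ has decision level at most $n$, and consider a clause-database state with parameter $n$ (as in the context) satisfying all four invariants. Let $\alpha\in D_a$ and $\beta\in D_b$ be distinct clauses, with $a,b\in\{0,1,\ldots,n,\infty\}$, such that $\alpha^{\le d}\subseteq\beta^{\le d}$ for some $d\in\mathbb{N}$, and let $k$ be the least such $d$. Suppose $b<k$. Form a new state as follows: if $a>k$, move $\alpha$ from $D_a$ to $D_k$; then remove $\beta$ from $D_b$ and add it to the stashed group $S_k^b$; all other groups are unchanged. Then the new state (with the same parameter $n$) satisfies all four invariants.
   Context: A clause is a finite set of pairwise distinct literals (read as their disjunction); a finite set of clauses is read as their conjunction (the empty set is true). Fix a CNF formula $I$ (the input clauses) and a trail $\tau=\langle \ell_1@d_1,\ldots,\ell_k@d_k\rangle$: a finite sequence of literals over pairwise distinct variables, each annotated with a decision level $d_j\in\mathbb{N}$, with $d_1\le\cdots\le d_k$ (and such that every literal that is not the first literal of its positive level is implied by $I$ together with the earlier first-literals-of-levels). For $d\in\mathbb{N}$, $\tau^{\le d}$ is the subsequence of literals with level $\le d$, viewed as a partial assignment. For a formula $\varphi$, $\tau^{\le d}\models\varphi$ means every total assignment extending $\tau^{\le d}$ satisfies $\varphi$. Write $\varphi\to^d\psi$ if $\tau^{\le d}\models(\varphi\to\psi)$ and $\varphi\leftrightarrow^d\psi$ if $\tau^{\le d}\models(\varphi\leftrightarrow\psi)$. For a clause $\alpha$, $\alpha^{\le d}=\{\ell\in\alpha : \neg\ell\notin\tau^{\le d}\}$ (remove literals falsified at level $\le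 d$). A clause-database state with parameter $n$ consists of pairwise disjoint finite sets of clauses: active groups $D_0,D_1,\ldots,D_n,D_\infty$ and stashed groups $S_k^q$ for $1\le k\le n$, $0\le q<k$. Notation: $S_k=\bigcup_{q<k}S_k^q$; $S=\bigcup_{k=1}^n S_k$; $S^i=\bigcup_{k} S_k^i$; $P=D_0\cup S^0$; $D=D_1\cup\cdots\cup D_n$; $N=D_0\cup D$; $A=N\cup D_\infty$. Invariants: (Input-equivalence) $I\leftrightarrow^0 P$. (Correctness) $N\leftrightarrow^n P$. (Representation) for every $i$ with $1\le i\le n$ and every $\alpha\in S_i$, at least one of: (a) there are $r$ with $0\le r\le i$ and $\beta\in D_r$ with $\beta\to^i\alpha$; (b) there are $r\le i$, $j$ with $i<j\le n$, and $\beta\in S_j^r$ with $\beta\to^i\alpha$; (c) $\tau^{\le i}\models\alpha$. (Closure) for every $\gamma\in A\cup S$, $P\to^0\gamma$. -}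

module Defs where

open import Data.Nat using (ℕ; zero; suc; _≤_; _<_; _<ᵇ_)
open import Data.Bool using (Bool; true; false; not; if_then_else_; _∧_)
open import Data.Product using (Σ; ∃; ∃-syntax; _×_; _,_; proj₁; proj₂)
open import Data.Sum using (_⊎_)
open import Data.Unit using (⊤)
open import Data.Empty using (⊥)
open import Data.Maybe using (Maybe; just; nothing)
open import Data.List using (List; map)
open import Data.List.Membership.Propositional using (_∈_)
open import Data.List.Relation.Unary.Any using (Any)
open import Data.List.Relation.Unary.Linked using (Linked)
open import Data.List.Relation.Unary.Unique.Propositional using (Unique)
open import Data.Fin using (Fin; toℕ)
open import Data.List using (length; lookup)
open import Relation.Nullary using (¬_; does)
open import Relation.Binary.PropositionalEquality using (_≡_; _≢_)
open import Relation.Binary.Definitions using (DecidableEquality)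
import Data.Nat.Properties as ℕP
import Data.Bool.Properties as BP
import Data.Product.Properties as PP
import Data.List.Properties as LP

-- a literal is a variable (a natural number) with a polarity
-- (true = positive literal x, false = negative literal ¬x)
Lit : Set
Lit = ℕ × Bool

neg : Lit → Lit
neg (x , p) = (x , not p)

-- a clause is a finite set of literals, represented by a list
-- (well-formed clauses have no repeated literals, see WFState)
Clause : Set
Clause = List Lit

CNF : Set
CNF = List Clause

Assignment : Set
Assignment = ℕ → Bool

_⊨ₗ_ : Assignment → Lit → Set
σ ⊨ₗ (x , p) = σ x ≡ p

_⊨c_ : Assignment → Clause → Set
σ ⊨c γ = Any (σ ⊨ₗ_) γ

_⊨cnf_ : Assignment → CNF → Set
σ ⊨cnf F = ∀ γ → γ ∈ F → σ ⊨c γ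

_≟ₗ_ : DecidableEquality Lit
_≟ₗ_ = PP.≡-dec ℕP._≟_ BP._≟_

_≟c_ : DecidableEquality Clause
_≟c_ = LP.≡-dec _≟ₗ_

Trail : Set
Trail = List (Lit × ℕ)

litAt : (τ : Trail) → Fin (length τ) → Lit
litAt τ j = proj₁ (lookup τ j)

lvlAt : (τ : Trail) → Fin (length τ) → ℕ
lvlAt τ j = proj₂ (lookup τ j)

IsDecision : (τ : Trail) → Fin (length τ) → Set
IsDecision τ j = (1 ≤ lvlAt τ j) × (∀ i → toℕ i < toℕ j → lvlAt τ i ≢ lvlAt τ j)

ImpliedAt : CNF → (τ : Trail) → Fin (length τ) → Set
ImpliedAt I τ j =
  ∀ (σ : Assignment) → σ ⊨cnf I →
    (∀ i → toℕ i < toℕ j → IsDecision τ i → σ ⊨ₗ litAt τ i) →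
    σ ⊨ₗ litAt τ j

IsTrail : CNF → Trail → Set
IsTrail I τ =
  Unique (map (λ e → proj₁ (proj₁ e)) τ) ×
  Linked _≤_ (map proj₂ τ) ×
  (∀ j → IsDecision τ j ⊎ ImpliedAt I τ j)

Extends : Trail → ℕ → Assignment → Set
Extends τ d σ = ∀ ℓ lv → (ℓ , lv) ∈ τ → lv ≤ d → σ ⊨ₗ ℓ

-- formulas are represented semantically, as predicates on total assignments
Formula : Set₁
Formula = Assignment → Set

Models : Trail → ℕ → Formula → Set
Models τ d φ = ∀ σ → Extends τ d σ → φ σ

Imp : Trail → ℕ → Formula → Formula → Set
Imp τ d φ ψ = ∀ σ → Extends τ d σ → φ σ → ψ σ

Iff : Trail → ℕ → Formula → Formula → Set
Iff τ d φ ψ = Imp τ d φ ψ × Imp τ d ψ φ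

FalsifiedAt : Trail → ℕ → Lit → Set
FalsifiedAt τ d ℓ = ∃[ lv ] ((neg ℓ , lv) ∈ τ × lv ≤ d)

_∈[_,_]_ : Lit → Trail → ℕ → Clause → Set
ℓ ∈[ τ , d ] α = ℓ ∈ α × ¬ FalsifiedAt τ d ℓ

SubAt : Trail → ℕ → Clause → Clause → Set
SubAt τ d α β = ∀ ℓ → ℓ ∈[ τ , d ] α → ℓ ∈[ τ , d ] β

data DIdx : Set where
  fin : ℕ → DIdx
  ∞   : DIdx

-- group names: D_a (active) or S_k^q (stashed)
data Grp : Set where
  D : DIdx → Grp
  S : ℕ → ℕ → Grp

ValidGrp : ℕ → Grp → Set
ValidGrp n (D (fin i)) = i ≤ n
ValidGrp n (D ∞)       = ⊤
ValidGrp n (S k q)     = (1 ≤ k) × (k ≤ n) × (q < k)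

-- a state assigns each clause to at most one group (so groups are
-- automatically pairwise disjoint); nothing = not in the database
State : Set
State = Clause → Maybe Grp

InState : State → Clause → Set
InState st γ = ∃[ g ] (st γ ≡ just g)

WFState : ℕ → State → Set
WFState n st =
  (∀ γ g → st γ ≡ just g → ValidGrp n g) ×
  (∃[ L ] (∀ γ → InState st γ → γ ∈ L)) ×
  (∀ γ → InState st γ → Unique γ) ×
  (∀ γ γ′ → InState st γ → InState st γ′ →
     (∀ ℓ → (ℓ ∈ γ → ℓ ∈ γ′) × (ℓ ∈ γ′ → ℓ ∈ γ)) → γ ≡ γ′)

SatGroups : State → (Grp → Set) → Formula
SatGroups st X σ = ∀ γ g → st γ ≡ just g → X g → σ ⊨c γ

InP : Grp → Set
InP (D (fin i)) = i ≡ 0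
InP (D ∞)       = ⊥
InP (S k q)     = q ≡ 0

InN : ℕ → Grp → Set
InN n (D (fin i)) = i ≤ n
InN n (D ∞)       = ⊥
InN n (S k q)     = ⊥

InAS : ℕ → Grp → Set
InAS n (D (fin i)) = i ≤ n
InAS n (D ∞)       = ⊤
InAS n (S k q)     = (1 ≤ k) × (k ≤ n) × (q < k)

InputEquivalence : CNF → Trail → State → Set
InputEquivalence I τ st = Iff τ 0 (λ σ → σ ⊨cnf I) (SatGroups st InP)

Correctness : Trail → ℕ → State → Set
Correctness τ n st = Iff τ n (SatGroups st (InN n)) (SatGroups st InP)

Representation : Trail → ℕ → State → Set
Representation τ n st =
  ∀ i → 1 ≤ i → i ≤ n → ∀ α → (∃[ q ] (q < i × st α ≡ just (S i q))) →
    (∃[ r ] ∃[ β ] (r ≤ i × st β ≡ just (D (fin r)) × Imp τ i (_⊨c β) (_⊨c α)))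
    ⊎ (∃[ r ] ∃[ j ] ∃[ β ] (r ≤ i × i < j × j ≤ n × st β ≡ just (S j r)
                              × Imp τ i (_⊨c β) (_⊨c α)))
    ⊎ Models τ i (_⊨c α)

Closure : Trail → ℕ → State → Set
Closure τ n st =
  ∀ γ g → st γ ≡ just g → InAS n g → Imp τ 0 (SatGroups st InP) (_⊨c γ)

Invariants : CNF → Trail → ℕ → State → Set
Invariants I τ n st =
  InputEquivalence I τ st × Correctness τ n st × Representation τ n st × Closure τ n st

gtB : DIdx → ℕ → Bool
gtB (fin a) k = k <ᵇ a
gtB ∞       k = true

step : State → (α β : Clause) → (a : DIdx) → (b k : ℕ) → State
step st α β a b k γ =
  if does (γ ≟c β) then just (S k b)
  else if does (γ ≟c α) ∧ gtB a k then just (D (fin k))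
  else st γ

{-# OPTIONS --safe #-}
-- Since α^{≤k} ⊆ β^{≤k}, α implies β at every level i ≥ k; as no trail literal lies above
-- level n, α^{≤n} ⊆ β^{≤n} too, so minimality gives k ≤ n. The step leaves P unchanged
-- (α can leave D_0 only if a > k ≥ 1, and β stays in P iff b = 0). N loses β, which α,
-- still in N, implies at level n, and gains at most α, which P entails by Closure. A clause
-- that was represented through β is now represented through β ∈ S_k^b below level k and
-- through α, at a level ≤ k, from level k on.
module Submission where

open import Defs
open import Data.Nat using (ℕ; zero; suc; _≤_; _<_; _⊓_; z≤n; s≤s; _<ᵇ_; _<?_)
open import Data.Nat.Properties
  using ( ≤-trans; ≤-refl; <⇒≤; ≮⇒≥; m<n⇒0<n; <ᵇ-reflects-<
        ; m⊓n≤m; m⊓n≤n; m≤n⇒m⊓n≡m; m≥n⇒m⊓n≡n)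
open import Data.Product using (_×_; proj₁; proj₂; _,_; ∃-syntax; map₂)
open import Data.Sum using (_⊎_; inj₁; inj₂)
open import Data.Bool using (true; false; if_then_else_)
open import Data.Bool.Properties using (not-¬)
open import Data.Unit using (tt)
open import Data.Empty using (⊥-elim)
open import Data.Maybe using (just)
open import Data.Maybe.Properties using (just-injective)
open import Data.List.Membership.Propositional using (_∈_; find; lose)
open import Function using (_∘_; case_of_)
open import Relation.Nullary using (¬_; yes; no)
open import Relation.Nullary.Reflects using (ofʸ; ofⁿ)
open import Relation.Binary.PropositionalEquality using (_≡_; _≢_; refl; sym; trans; subst; cong)

⊨ₗ-neg : ∀ σ ℓ → σ ⊨ₗ ℓ → ¬ σ ⊨ₗ neg ℓ
⊨ₗ-neg _ (x , p) σx≡p σx≡¬p = not-¬ refl (trans (sym σx≡p) σx≡¬p)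

Extends-mono : ∀ {τ d e σ} → d ≤ e → Extends τ e σ → Extends τ d σ
Extends-mono d≤e ext ℓ lv mem lv≤d = ext ℓ lv mem (≤-trans lv≤d d≤e)

FalsifiedAt-mono : ∀ {τ d e ℓ} → d ≤ e → FalsifiedAt τ d ℓ → FalsifiedAt τ e ℓ
FalsifiedAt-mono d≤e (lv , mem , lv≤d) = lv , mem , ≤-trans lv≤d d≤e

FalsifiedAt-bounded : ∀ {τ m d ℓ} → (∀ e → e ∈ τ → proj₂ e ≤ m) →
  FalsifiedAt τ d ℓ → FalsifiedAt τ m ℓ
FalsifiedAt-bounded bound (lv , mem , _) = lv , mem , bound _ mem

satisfied⇒¬FalsifiedAt : ∀ {τ d e σ ℓ} → d ≤ e → Extends τ e σ → σ ⊨ₗ ℓ →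
  ¬ FalsifiedAt τ d ℓ
satisfied⇒¬FalsifiedAt {σ = σ} d≤e ext σℓ (lv , mem , lv≤d) =
  ⊨ₗ-neg σ _ σℓ (ext _ lv mem (≤-trans lv≤d d≤e))

SubAt⇒Imp : ∀ {τ d e α β} → d ≤ e → SubAt τ d α β → Imp τ e (_⊨c α) (_⊨c β)
SubAt⇒Imp d≤e sub σ ext σα with find σα
... | ℓ , ℓ∈α , σℓ = lose (proj₁ (sub ℓ (ℓ∈α , satisfied⇒¬FalsifiedAt d≤e ext σℓ))) σℓ

SubAt-bounded : ∀ {τ m d α β} → (∀ e → e ∈ τ → proj₂ e ≤ m) → m ≤ d →
  SubAt τ d α β → SubAt τ m α β
SubAt-bounded bound m≤d sub ℓ (ℓ∈α , ¬falsified) =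
  map₂ (_∘ FalsifiedAt-mono m≤d) (sub ℓ (ℓ∈α , ¬falsified ∘ FalsifiedAt-bounded bound))

least-SubAt≤bound : ∀ {τ n k α β} → (∀ e → e ∈ τ → proj₂ e ≤ n) →
  SubAt τ k α β → (∀ d → d < k → ¬ SubAt τ d α β) → k ≤ n
least-SubAt≤bound bound sub least =
  ≮⇒≥ (λ n<k → least _ n<k (SubAt-bounded bound (<⇒≤ n<k) sub))

ValidGrp⇒InAS : ∀ {n} g → ValidGrp n g → InAS n g
ValidGrp⇒InAS (D (fin i)) i≤n = i≤n
ValidGrp⇒InAS (D ∞)       _   = tt
ValidGrp⇒InAS (S k q)     v   = v

SatGroups-⊆ : ∀ {st st′ X Y} →
  (∀ γ g → st′ γ ≡ just g → X g → ∃[ g′ ] (st γ ≡ just g′ × Y g′)) →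
  ∀ σ → SatGroups st Y σ → SatGroups st′ X σ
SatGroups-⊆ ⊆ σ sat γ g eq x with ⊆ γ g eq x
... | g′ , eq′ , y = sat γ g′ eq′ y

WFState-⊆ : ∀ {n st st′} → (∀ γ g → st′ γ ≡ just g → ValidGrp n g) →
  (∀ γ → InState st′ γ → InState st γ) → WFState n st → WFState n st′
WFState-⊆ valid′ ⊆ (_ , (L , finite) , unique , extensional) =
  valid′ ,
  (L , λ γ → finite γ ∘ ⊆ γ) ,
  (λ γ → unique γ ∘ ⊆ γ) ,
  (λ γ γ′ h h′ → extensional γ γ′ (⊆ γ h) (⊆ γ′ h′))

Closure-⊆ : ∀ {τ n st st′} → WFState n st → (∀ γ → InState st′ γ → InState st γ) →
  (∀ σ → SatGroups st′ InP σ → SatGroups st InP σ) → Closure τ n st → Closure τ n st′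
Closure-⊆ wf ⊆ P′⇒P closure γ g eq _ σ ext satP′ with ⊆ γ (g , eq)
... | g′ , eq′ = closure γ g′ eq′ (ValidGrp⇒InAS g′ (proj₁ wf γ g′ eq′)) σ ext (P′⇒P σ satP′)

RepresentedAt : Trail → ℕ → State → ℕ → Clause → Set
RepresentedAt τ n st i γ =
  (∃[ r ] ∃[ β ] (r ≤ i × st β ≡ just (D (fin r)) × Imp τ i (_⊨c β) (_⊨c γ)))
  ⊎ (∃[ r ] ∃[ j ] ∃[ β ] (r ≤ i × i < j × j ≤ n × st β ≡ just (S j r)
                            × Imp τ i (_⊨c β) (_⊨c γ)))
  ⊎ Models τ i (_⊨c γ)

-- min(a, k) with ∞ on top: the level of α after step moves it from D_a to D_k when a > k.
_⊓ᴰ_ : DIdx → ℕ → ℕ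
fin a ⊓ᴰ k = a ⊓ k
∞     ⊓ᴰ k = k

⊓ᴰ-≤ʳ : ∀ a k → a ⊓ᴰ k ≤ k
⊓ᴰ-≤ʳ (fin a) k = m⊓n≤n a k
⊓ᴰ-≤ʳ ∞       k = ≤-refl

⊓ᴰ-≤ˡ : ∀ {a r} k → a ≡ fin r → a ⊓ᴰ k ≤ r
⊓ᴰ-≤ˡ {r = r} k refl = m⊓n≤m r k

InP-⊓ᴰ : ∀ a k → InP (D a) → InP (D (fin (a ⊓ᴰ k)))
InP-⊓ᴰ (fin zero) k refl = refl

InP-⊓ᴰ⁻ : ∀ a {k} → 0 < k → InP (D (fin (a ⊓ᴰ k))) → InP (D a)
InP-⊓ᴰ⁻ (fin zero)    {suc k} _ _  = refl
InP-⊓ᴰ⁻ (fin (suc a)) {suc k} _ ()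
InP-⊓ᴰ⁻ ∞             {suc k} _ ()

just-D-injective : ∀ {x y} → just (D x) ≡ just (D y) → x ≡ y
just-D-injective refl = refl

module StepProperties {st : State} {α β : Clause} {a : DIdx} {b k : ℕ}
  (α≢β : α ≢ β) (stα : st α ≡ just (D a)) (stβ : st β ≡ just (D (fin b))) where

  st′ : State
  st′ = step st α β a b k

  step-β : st′ β ≡ just (S k b)
  step-β with β ≟c β
  ... | yes _   = refl
  ... | no β≢β = ⊥-elim (β≢β refl)

  step-α : st′ α ≡ just (D (fin (a ⊓ᴰ k)))
  step-α with α ≟c β | α ≟c α
  ... | yes α≡β | _       = ⊥-elim (α≢β α≡β)
  ... | no _    | no α≢α = ⊥-elim (α≢α refl)
  ... | no _    | yes _   = moved a stα
    where
    moved : ∀ a → st α ≡ just (D a) →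
      (if gtB a k then just (D (fin k)) else st α) ≡ just (D (fin (a ⊓ᴰ k)))
    moved ∞       _   = refl
    moved (fin a) stα with k <ᵇ a | <ᵇ-reflects-< k a
    ... | true  | ofʸ k<a = cong (just ∘ D ∘ fin) (sym (m≥n⇒m⊓n≡n (<⇒≤ k<a)))
    ... | false | ofⁿ k≮a = trans stα (cong (just ∘ D ∘ fin) (sym (m≤n⇒m⊓n≡m (≮⇒≥ k≮a))))

  step-other : ∀ {γ} → γ ≢ α → γ ≢ β → st′ γ ≡ st γ
  step-other {γ} γ≢α γ≢β with γ ≟c β | γ ≟c α
  ... | yes γ≡β | _       = ⊥-elim (γ≢β γ≡β)
  ... | no _    | yes γ≡α = ⊥-elim (γ≢α γ≡α)
  ... | no _    | no _    = refl

  data Site : Clause → Set where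
    at-β      : Site β
    at-α      : Site α
    elsewhere : ∀ {γ} → γ ≢ α → γ ≢ β → Site γ

  site : ∀ γ → Site γ
  site γ with γ ≟c β | γ ≟c α
  ... | yes refl | _        = at-β
  ... | no _     | yes refl = at-α
  ... | no γ≢β   | no γ≢α   = elsewhere γ≢α γ≢β

  data _↦_ : Clause → Grp → Set where
    β↦   : β ↦ S k b
    α↦   : α ↦ D (fin (a ⊓ᴰ k))
    kept : ∀ {γ g} → γ ≢ α → γ ≢ β → st γ ≡ just g → γ ↦ g

  classify : ∀ {γ g} → st′ γ ≡ just g → γ ↦ g
  classify {γ} eq with site γ
  ... | at-β = subst (β ↦_) (just-injective (trans (sym step-β) eq)) β↦
  ... | at-α = subst (α ↦_) (just-injective (trans (sym step-α) eq)) α↦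
  ... | elsewhere γ≢α γ≢β = kept γ≢α γ≢β (trans (sym (step-other γ≢α γ≢β)) eq)

  step-⊆ : ∀ γ → InState st′ γ → InState st γ
  step-⊆ γ (_ , eq) with classify {γ} eq
  ... | β↦ = _ , stβ
  ... | α↦ = _ , stα
  ... | kept _ _ eq′ = _ , eq′

  step-keeps-S : ∀ {γ j r} → st γ ≡ just (S j r) → st′ γ ≡ just (S j r)
  step-keeps-S {γ} eq with site γ
  ... | at-β = case trans (sym stβ) eq of λ ()
  ... | at-α = case trans (sym stα) eq of λ ()
  ... | elsewhere γ≢α γ≢β = trans (step-other γ≢α γ≢β) eq

  P⊆P′ : ∀ γ g → st γ ≡ just g → InP g → ∃[ g′ ] (st′ γ ≡ just g′ × InP g′)
  P⊆P′ γ g eq p with site γ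
  ... | at-β with trans (sym stβ) eq
  ...   | refl = _ , step-β , p
  P⊆P′ γ g eq p | at-α with trans (sym stα) eq
  ...   | refl = _ , step-α , InP-⊓ᴰ a k p
  P⊆P′ γ g eq p | elsewhere γ≢α γ≢β = g , trans (step-other γ≢α γ≢β) eq , p

  P′⇒P : ∀ σ → SatGroups st′ InP σ → SatGroups st InP σ
  P′⇒P = SatGroups-⊆ P⊆P′

  module _ (0<k : 0 < k) where

    P′⊆P : ∀ γ g → st′ γ ≡ just g → InP g → ∃[ g′ ] (st γ ≡ just g′ × InP g′)
    P′⊆P γ g eq p with classify {γ} eq
    ... | β↦ = _ , stβ , p
    ... | α↦ = _ , stα , InP-⊓ᴰ⁻ a 0<k p
    ... | kept _ _ eq′ = _ , eq′ , p

    P⇒P′ : ∀ σ → SatGroups st InP σ → SatGroups st′ InP σ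
    P⇒P′ = SatGroups-⊆ P′⊆P

    step-InputEquivalence : ∀ {I τ} → InputEquivalence I τ st → InputEquivalence I τ st′
    step-InputEquivalence (I⇒P , P⇒I) =
      (λ σ ext → P⇒P′ σ ∘ I⇒P σ ext) , (λ σ ext → P⇒I σ ext ∘ P′⇒P σ)

  step-Closure : ∀ {τ n} → WFState n st → Closure τ n st → Closure τ n st′
  step-Closure wf = Closure-⊆ wf step-⊆ P′⇒P

  step-WFState : ∀ {n} → b < k → k ≤ n → WFState n st → WFState n st′
  step-WFState {n} b<k k≤n wf = WFState-⊆ valid′ step-⊆ wf
    where
    valid′ : ∀ γ g → st′ γ ≡ just g → ValidGrp n g
    valid′ γ g eq with classify {γ} eq
    ... | β↦ = m<n⇒0<n b<k , k≤n , b<k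
    ... | α↦ = ≤-trans (⊓ᴰ-≤ʳ a k) k≤n
    ... | kept _ _ eq′ = proj₁ wf γ g eq′

  module _ {τ n} (k≤n : k ≤ n) (sub : SubAt τ k α β) where

    N′⇒α : ∀ σ → SatGroups st′ (InN n) σ → σ ⊨c α
    N′⇒α σ satN′ = satN′ α _ step-α (≤-trans (⊓ᴰ-≤ʳ a k) k≤n)

    N′⇒N : Imp τ n (SatGroups st′ (InN n)) (SatGroups st (InN n))
    N′⇒N σ ext satN′ γ g eq inN with site γ
    ... | at-β = SubAt⇒Imp k≤n sub σ ext (N′⇒α σ satN′)
    ... | at-α = N′⇒α σ satN′
    ... | elsewhere γ≢α γ≢β = satN′ γ g (trans (step-other γ≢α γ≢β) eq) inN

    N∧α⇒N′ : ∀ σ → SatGroups st (InN n) σ → σ ⊨c α → SatGroups st′ (InN n) σ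
    N∧α⇒N′ σ satN σα γ g eq inN with classify {γ} eq
    ... | α↦ = σα
    ... | kept _ _ eq′ = satN γ g eq′ inN

    step-Correctness : 0 < k → WFState n st → Closure τ n st → Correctness τ n st →
      Correctness τ n st′
    step-Correctness 0<k wf closure (N⇒P , P⇒N) =
      (λ σ ext → P⇒P′ 0<k σ ∘ N⇒P σ ext ∘ N′⇒N σ ext) ,
      (λ σ ext satP′ → let satP = P′⇒P σ satP′ in
        N∧α⇒N′ σ (P⇒N σ ext satP) (P⇒α σ (Extends-mono z≤n ext) satP))
      where
      P⇒α : Imp τ 0 (SatGroups st InP) (_⊨c α)
      P⇒α = closure α (D a) stα (ValidGrp⇒InAS (D a) (proj₁ wf α (D a) stα))

    represented-by-α : ∀ {i γ} → a ⊓ᴰ k ≤ i → Imp τ i (_⊨c α) (_⊨c γ) →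
      RepresentedAt τ n st′ i γ
    represented-by-α le α⇒γ = inj₁ (_ , α , le , step-α , α⇒γ)

    represented-by-active : ∀ {i γ r β′} → r ≤ i → st β′ ≡ just (D (fin r)) →
      Imp τ i (_⊨c β′) (_⊨c γ) → RepresentedAt τ n st′ i γ
    represented-by-active {i} {β′ = β′} r≤i eq β′⇒γ with site β′
    ... | at-β with trans (sym stβ) eq
    ...   | refl with i <? k
    ...     | yes i<k = inj₂ (inj₁ (b , k , β , r≤i , i<k , k≤n , step-β , β′⇒γ))
    ...     | no i≮k  = represented-by-α (≤-trans (⊓ᴰ-≤ʳ a k) (≮⇒≥ i≮k))
                          (λ σ ext → β′⇒γ σ ext ∘ SubAt⇒Imp (≮⇒≥ i≮k) sub σ ext)
    represented-by-active r≤i eq β′⇒γ | at-α =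
      represented-by-α (≤-trans (⊓ᴰ-≤ˡ k (just-D-injective (trans (sym stα) eq))) r≤i) β′⇒γ
    represented-by-active r≤i eq β′⇒γ | elsewhere β′≢α β′≢β =
      inj₁ (_ , _ , r≤i , trans (step-other β′≢α β′≢β) eq , β′⇒γ)

    step-represented : ∀ {i γ} → RepresentedAt τ n st i γ → RepresentedAt τ n st′ i γ
    step-represented (inj₁ (r , β′ , r≤i , eq , β′⇒γ)) = represented-by-active r≤i eq β′⇒γ
    step-represented (inj₂ (inj₁ (r , j , β′ , r≤i , i<j , j≤n , eq , β′⇒γ))) =
      inj₂ (inj₁ (r , j , β′ , r≤i , i<j , j≤n , step-keeps-S eq , β′⇒γ))
    step-represented (inj₂ (inj₂ models)) = inj₂ (inj₂ models)

    step-Representation : Representation τ n st → Representation τ n st′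
    step-Representation rep i 1≤i i≤n γ (q , q<i , eq) with classify {γ} eq
    ... | β↦ = represented-by-α (⊓ᴰ-≤ʳ a k) (SubAt⇒Imp ≤-refl sub)
    ... | kept _ _ eq′ = step-represented (rep i 1≤i i≤n γ (q , q<i , eq′))

lemma3 : (I : CNF) (τ : Trail) (n : ℕ) → IsTrail I τ →
    (∀ e → e ∈ τ → proj₂ e ≤ n) →
    (st : State) → WFState n st → Invariants I τ n st →
    (α β : Clause) (a : DIdx) (b : ℕ) →
    st α ≡ just (D a) → st β ≡ just (D (fin b)) → α ≢ β →
    (k : ℕ) → SubAt τ k α β → (∀ d → d < k → ¬ SubAt τ d α β) →
    b < k →
    WFState n (step st α β a b k) × Invariants I τ n (step st α β a b k)
lemma3 I τ n _ bound st wf (ie , corr , rep , closure) α β a b stα stβ α≢β k sub least b<k =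
  step-WFState b<k k≤n wf ,
  step-InputEquivalence 0<k ie ,
  step-Correctness k≤n sub 0<k wf closure corr ,
  step-Representation k≤n sub rep ,
  step-Closure wf closure
  where
  open StepProperties {k = k} α≢β stα stβ
  k≤n : k ≤ n
  k≤n = least-SubAt≤bound bound sub least
  0<k : 0 < k
  0<k = m<n⇒0<n b<k
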